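{- Let $R$ be a commutative ring with $1$ and $\mathcal{A}$ a set of non-commuting symbols. A normalized $R$-valued multiple Dedekind symbol $D_{\mathcal{A}}$ based on $\mathcal{A}$ is shuffled if and only if its associated multiple reciprocity function $F_{\mathcal{A}}(p,q)=D_{\mathcal{A}}(p,q)D_{\mathcal{A}}(-q,p)^{ -1}$ is shuffled.
   Context: $\mathcal{A}^*$ is the set of words in $\mathcal{A}$ (including $\emptyset$), $R\langle\langle\mathcal{A}\rangle\rangle$ the ring of non-commutative formal power series $\sum_{w\in\mathcal{A}^*}c_ww$ with unit group $R\langle\langle\mathcal{A}\rangle\rangle^\times$, $U=\{(p,q)\in\mathbb{Z}^2:\gcd(p,q)=1\}$. An $R$-valued multiple Dedekind symbol based on $\mathcal{A}$ is a map $D:U\to R\langle\langle\mathcal{A}\rangle\rangle^\times$ of the form $1+\sum_{w\neq\emptyset}D^w(p,q)w$ with $D(p,-q)=D(-p,q)$ and $D(p,q)=D(p,p+q)$; it is normalized if $D(1,1)=1$. An $R$-valued multiple reciprocity function based on $\mathcal{A}$ is a map $F:U\to R\langle\langle\mathcal{A}\rangle\rangle^\times$ of the form $1+\sum_{w\neq\emptyset}F^w(p,q)w$ with $F(p,-q)=F(-p,q)$, $F(p,q)F(-q,p)=1$, $F(p,p+q)F(p+q,q)=F(p,q)$. Set $D^\emptyset=F^\emptyset=1$. For words $u=a_1\cdots a_r$, $v=a_{r+1}\cdots a_{r+s}$, $Sh(u,v)$ is the multiset of words $a_{\sigma^{ -1}(1)}\cdots a_{\sigma^{ -1}(r+s)}$,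 one for each permutation $\sigma$ with $\sigma(1)<\dots<\sigma(r)$, $\sigma(r+1)<\dots<\sigma(r+s)$ (sums over it counted with multiplicity). $D$ (resp. $F$) is called shuffled if $D^u(p,q)D^v(p,q)=\sum_{w\in Sh(u,v)}D^w(p,q)$ (resp. the same with $F$) for all $u,v\in\mathcal{A}^*$ and all $(p,q)\in U$. -}

module Defs where

open import Level using (_⊔_)
open import Algebra.Bundles using (CommutativeRing)
open import Data.List using (List; []; _∷_; map; foldr; _++_; length)
open import Data.Nat using (ℕ; zero; suc)
open import Data.Product using (_×_; _,_)
open import Data.Integer using (ℤ; 1ℤ)
import Data.Integer as ℤ
open import Data.Integer.Coprimality using (Coprime)

splits : ∀ {a} {A : Set a} → List A → List (List A × List A)
splits []      = ([] , []) ∷ []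
splits (x ∷ w) = ([] , x ∷ w) ∷ map (λ { (u , v) → (x ∷ u , v) }) (splits w)

-- The shuffle multiset Sh(u,v), as a list (entries counted with multiplicity).
Sh : ∀ {a} {A : Set a} → List A → List A → List (List A)
Sh []      v       = v ∷ []
Sh (x ∷ u) []      = (x ∷ u) ∷ []
Sh (x ∷ u) (y ∷ v) = map (x ∷_) (Sh u (y ∷ v)) ++ map (y ∷_) (Sh (x ∷ u) v)

module _ {a c ℓ} {A : Set a} (R : CommutativeRing c ℓ) where
  open CommutativeRing R

  -- Non-commutative formal power series R⟨⟨A⟩⟩: coefficient function on words A*.
  Series : Set (a ⊔ c)
  Series = List A → Carrier

  sumR : List Carrier → Carrier
  sumR = foldr _+_ 0#

  _≈ₛ_ : Series → Series → Set (a ⊔ ℓ)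
  f ≈ₛ g = ∀ w → f w ≈ g w

  oneₛ : Series
  oneₛ []      = 1#
  oneₛ (_ ∷ _) = 0#

  _*ₛ_ : Series → Series → Series
  (f *ₛ g) w = sumR (map (λ { (u , v) → f u * g v }) (splits w))

  -- Inverse of a series with constant term 1 (recursion on word length, via fuel):
  -- g(∅) = 1,  g(x w) = - Σ_{w = u v} f(x u) g(v),  so that f g = 1.
  invAux : ℕ → Series → Series
  invAux _       f []      = 1#
  invAux zero    f (_ ∷ _) = 0#
  invAux (suc n) f (x ∷ w) =
    - sumR (map (λ { (u , v) → f (x ∷ u) * invAux n f v }) (splits w))

  invₛ : Series → Series
  invₛ f w = invAux (length w) f w

  -- maps U → R⟨⟨A⟩⟩ (values off U = {(p,q) : gcd(p,q)=1} are irrelevant)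
  SymbolMap : Set (a ⊔ c)
  SymbolMap = ℤ → ℤ → Series

  record IsMultipleDedekindSymbol (D : SymbolMap) : Set (a ⊔ ℓ) where
    field
      const-one : ∀ p q → Coprime p q → D p q [] ≈ 1#
      sym-sign  : ∀ p q → Coprime p q → D p (ℤ.- q) ≈ₛ D (ℤ.- p) q
      periodic  : ∀ p q → Coprime p q → D p q ≈ₛ D p (p ℤ.+ q)

  Normalized : SymbolMap → Set (a ⊔ ℓ)
  Normalized D = D 1ℤ 1ℤ ≈ₛ oneₛ

  Shuffled : SymbolMap → Set (a ⊔ ℓ)
  Shuffled D = ∀ (u v : List A) p q → Coprime p q →
    D p q u * D p q v ≈ sumR (map (D p q) (Sh u v))

  assocReciprocity : SymbolMap → SymbolMap
  assocReciprocity D p q = D p q *ₛ invₛ (D (ℤ.- q) p)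

-- A series f is shuffled when prodForm f (u, v) = f u · f v equals
-- shuffleForm f (u, v) = Σ_{w ∈ Sh(u,v)} f w.  Both forms turn the Cauchy product
-- of series into the convolution ⋆ of functions of pairs of words (for shuffleForm
-- this is the compatibility of shuffling with deconcatenation), and a factor with
-- constant term 1 can be cancelled from ⋆ by induction on total word length.  So
-- shuffled series with constant term 1 are closed under products and inverses, which
-- gives F(p,q) = D(p,q) D(-q,p)⁻¹ shuffled from D shuffled, and D(p,q) shuffled from
-- F(p,q) and D(-q,p) shuffled.  For the converse, periodicity moves (p, q) to
-- (p, q mod p), the reciprocity step to (-(q mod p), p), and this Euclidean descent
-- ends at (0, ±1), which the sign symmetry, periodicity and D(1,1) = 1 settle.
module Submission where

open import Defs
open import Level using (_⊔_)
open import Algebra.Bundles using (CommutativeRing)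
open import Data.List using (List; []; _∷_; map; _++_; length)
open import Data.List.Relation.Unary.All as All using (All; []; _∷_)
import Data.List.Relation.Unary.All.Properties as All
open import Data.Nat as ℕ using (ℕ; zero; suc; _≤_; _<_; z≤n; s≤s)
import Data.Nat.Properties as ℕ
open import Data.Nat.Induction using (<-wellFounded)
open import Data.Product using (_×_; _,_; map₁)
open import Data.Integer as ℤ using (ℤ; +_; -[1+_]; ∣_∣; 0ℤ; 1ℤ)
import Data.Integer.Properties as ℤ
import Data.Integer.DivMod as ℤ
import Data.Integer.Divisibility.Signed as ℤ
open import Data.Integer.Coprimality using (Coprime)
import Data.Integer.Coprimality as ℤCoprime
import Data.Nat.Coprimality as ℕCoprime
open import Data.Integer.Tactic.RingSolver using (solve-∀)
open import Function.Bundles using (_⇔_; mk⇔; Equivalence)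
import Function.Properties.Equivalence as ⇔
import Induction.WellFounded as WF
import Relation.Binary.Construct.On as On
open import Relation.Binary.PropositionalEquality as ≡ using (_≡_)

module ShuffleAlgebra {a c ℓ} (R : CommutativeRing c ℓ) (A : Set a) where
  open CommutativeRing R
  open import Relation.Binary.Reasoning.Setoid setoid
  open import Algebra.Properties.Group +-group using (∙-cancelˡ; ∙-cancelʳ)
  open import Algebra.Solver.CommutativeMonoid +-commutativeMonoid using (solve; _⊕_; _⊜_)
  open import Algebra.Properties.CommutativeSemigroup +-commutativeSemigroup
    using () renaming (interchange to +-interchange)
  open import Algebra.Properties.CommutativeSemigroup *-commutativeSemigroup
    using () renaming (interchange to *-interchange)

  Word : Set a
  Word = List A

  Ser : Set (a ⊔ c)
  Ser = Series {A = A} R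

  ∑ : ∀ {b} {X : Set b} → List X → (X → Carrier) → Carrier
  ∑ xs h = sumR {A = A} R (map h xs)

  module _ {b} {X : Set b} where

    ∑-congᴬ : ∀ {xs : List X} {h k} → All (λ x → h x ≈ k x) xs → ∑ xs h ≈ ∑ xs k
    ∑-congᴬ []       = refl
    ∑-congᴬ (e ∷ es) = +-cong e (∑-congᴬ es)

    ∑-cong : ∀ (xs : List X) {h k} → (∀ x → h x ≈ k x) → ∑ xs h ≈ ∑ xs k
    ∑-cong xs e = ∑-congᴬ {xs} (All.tabulate (λ {x} _ → e x))

    ∑-++ : ∀ (xs ys : List X) h → ∑ (xs ++ ys) h ≈ ∑ xs h + ∑ ys h
    ∑-++ []       ys h = sym (+-identityˡ _)
    ∑-++ (x ∷ xs) ys h = trans (+-congˡ (∑-++ xs ys h)) (sym (+-assoc _ _ _))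

    ∑-distrib-+ : ∀ (xs : List X) h k → ∑ xs (λ x → h x + k x) ≈ ∑ xs h + ∑ xs k
    ∑-distrib-+ []       h k = sym (+-identityˡ _)
    ∑-distrib-+ (x ∷ xs) h k = trans (+-congˡ (∑-distrib-+ xs h k)) (+-interchange _ _ _ _)

    *-distribˡ-∑ : ∀ (xs : List X) z h → z * ∑ xs h ≈ ∑ xs (λ x → z * h x)
    *-distribˡ-∑ []       z h = zeroʳ z
    *-distribˡ-∑ (x ∷ xs) z h = trans (distribˡ _ _ _) (+-congˡ (*-distribˡ-∑ xs z h))

    *-distribʳ-∑ : ∀ (xs : List X) z h → ∑ xs h * z ≈ ∑ xs (λ x → h x * z)
    *-distribʳ-∑ []       z h = zeroˡ z
    *-distribʳ-∑ (x ∷ xs) z h = trans (distribʳ _ _ _) (+-congˡ (*-distribʳ-∑ xs z h))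

    ∑-zero : ∀ (xs : List X) → ∑ xs (λ _ → 0#) ≈ 0#
    ∑-zero []       = refl
    ∑-zero (x ∷ xs) = trans (+-congˡ (∑-zero xs)) (+-identityˡ _)

  ∑-map : ∀ {b d} {X : Set b} {Y : Set d} (xs : List X) (g : X → Y) h →
          ∑ (map g xs) h ≈ ∑ xs (λ x → h (g x))
  ∑-map []       g h = refl
  ∑-map (x ∷ xs) g h = +-congˡ (∑-map xs g h)

  infixl 7 _·_
  _·_ : Ser → Ser → Ser
  _·_ = _*ₛ_ {A = A} R

  ∂ : A → Ser → Ser
  ∂ x f w = f (x ∷ w)

  ·-∂ : ∀ f g x w → (f · g) (x ∷ w) ≈ f [] * ∂ x g w + (∂ x f · g) w
  ·-∂ f g x w = +-congˡ (∑-map (splits w) (map₁ (x ∷_)) _)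

  BiSer : Set (a ⊔ c)
  BiSer = Word → Word → Carrier

  infix 4 _≋_
  _≋_ : BiSer → BiSer → Set (a ⊔ ℓ)
  F ≋ G = ∀ u v → F u v ≈ G u v

  infixl 7 _⋆_
  _⋆_ : BiSer → BiSer → BiSer
  (F ⋆ G) u v = ∑ (splits u) λ (u₁ , u₂) → ∑ (splits v) λ (v₁ , v₂) → F u₁ v₁ * G u₂ v₂

  ⋆-cong : ∀ {F F′ G G′} → F ≋ F′ → G ≋ G′ → F ⋆ G ≋ F′ ⋆ G′
  ⋆-cong F≋F′ G≋G′ u v =
    ∑-cong (splits u) λ _ → ∑-cong (splits v) λ _ → *-cong (F≋F′ _ _) (G≋G′ _ _)

  ⋆-distribʳ-+ : ∀ F G H u v →
    ((λ u′ v′ → F u′ v′ + G u′ v′) ⋆ H) u v ≈ (F ⋆ H) u v + (G ⋆ H) u v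
  ⋆-distribʳ-+ F G H u v = begin
    ((λ u′ v′ → F u′ v′ + G u′ v′) ⋆ H) u v
      ≈⟨ ∑-cong (splits u) (λ _ → ∑-cong (splits v) λ _ → distribʳ _ _ _) ⟩
    ∑ (splits u) (λ (u₁ , u₂) → ∑ (splits v) λ (v₁ , v₂) → F u₁ v₁ * H u₂ v₂ + G u₁ v₁ * H u₂ v₂)
      ≈⟨ ∑-cong (splits u) (λ _ → ∑-distrib-+ (splits v) _ _) ⟩
    ∑ (splits u) (λ (u₁ , u₂) → ∑ (splits v) (λ (v₁ , v₂) → F u₁ v₁ * H u₂ v₂)
                              + ∑ (splits v) (λ (v₁ , v₂) → G u₁ v₁ * H u₂ v₂))
      ≈⟨ ∑-distrib-+ (splits u) _ _ ⟩
    (F ⋆ H) u v + (G ⋆ H) u v ∎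

  ⋆-consˡ : ∀ F G x u v → (F ⋆ G) (x ∷ u) v ≈
    ∑ (splits v) (λ (v₁ , v₂) → F [] v₁ * G (x ∷ u) v₂) + ((λ u′ → F (x ∷ u′)) ⋆ G) u v
  ⋆-consˡ F G x u v = +-congˡ (∑-map (splits u) (map₁ (x ∷_)) _)

  ⋆-consʳ : ∀ F G u y v → (F ⋆ G) u (y ∷ v) ≈
    ∑ (splits u) (λ (u₁ , u₂) → F u₁ [] * G u₂ (y ∷ v)) + ((λ u′ v′ → F u′ (y ∷ v′)) ⋆ G) u v
  ⋆-consʳ F G u y v = trans
    (∑-cong (splits u) (λ _ → +-congˡ (∑-map (splits v) (map₁ (y ∷_)) _)))
    (∑-distrib-+ (splits u) _ _)

  prodForm : Ser → BiSer
  prodForm f u v = f u * f v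

  shuffleForm : Ser → BiSer
  shuffleForm f u v = ∑ (Sh u v) f

  IsShuffle : Ser → Set (a ⊔ ℓ)
  IsShuffle f = prodForm f ≋ shuffleForm f

  prodForm-· : ∀ f g → prodForm (f · g) ≋ prodForm f ⋆ prodForm g
  prodForm-· f g u v = begin
    (f · g) u * (f · g) v
      ≈⟨ *-distribʳ-∑ (splits u) _ _ ⟩
    ∑ (splits u) (λ (u₁ , u₂) → f u₁ * g u₂ * (f · g) v)
      ≈⟨ ∑-cong (splits u) (λ _ → *-distribˡ-∑ (splits v) _ _) ⟩
    ∑ (splits u) (λ (u₁ , u₂) → ∑ (splits v) λ (v₁ , v₂) → f u₁ * g u₂ * (f v₁ * g v₂))
      ≈⟨ ∑-cong (splits u) (λ _ → ∑-cong (splits v) λ _ → *-interchange _ _ _ _) ⟩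
    (prodForm f ⋆ prodForm g) u v ∎

  shuffleForm-[]ʳ : ∀ f w → shuffleForm f w [] ≈ f w
  shuffleForm-[]ʳ f []      = +-identityʳ _
  shuffleForm-[]ʳ f (_ ∷ _) = +-identityʳ _

  shuffleForm-∷ : ∀ f x u y v → shuffleForm f (x ∷ u) (y ∷ v) ≈
    shuffleForm (∂ x f) u (y ∷ v) + shuffleForm (∂ y f) (x ∷ u) v
  shuffleForm-∷ f x u y v = trans (∑-++ (map (x ∷_) (Sh u (y ∷ v))) _ f)
    (+-cong (∑-map (Sh u (y ∷ v)) (x ∷_) f) (∑-map (Sh (x ∷ u) v) (y ∷_) f))

  shuffleForm-·-∂ : ∀ f g x u v → shuffleForm (∂ x (f · g)) u v ≈
    f [] * shuffleForm (∂ x g) u v + shuffleForm (∂ x f · g) u v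
  shuffleForm-·-∂ f g x u v = begin
    ∑ (Sh u v) (∂ x (f · g))
      ≈⟨ ∑-cong (Sh u v) (·-∂ f g x) ⟩
    ∑ (Sh u v) (λ w → f [] * ∂ x g w + (∂ x f · g) w)
      ≈⟨ ∑-distrib-+ (Sh u v) _ _ ⟩
    ∑ (Sh u v) (λ w → f [] * ∂ x g w) + ∑ (Sh u v) (∂ x f · g)
      ≈⟨ +-congʳ (sym (*-distribˡ-∑ (Sh u v) _ _)) ⟩
    f [] * shuffleForm (∂ x g) u v + shuffleForm (∂ x f · g) u v ∎

  -- The bialgebra compatibility of the shuffle product with deconcatenation.
  shuffleForm-· : ∀ f g → shuffleForm (f · g) ≋ shuffleForm f ⋆ shuffleForm g
  shuffleForm-· f g [] v = begin
    shuffleForm (f · g) [] v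
      ≈⟨ +-identityʳ _ ⟩
    (f · g) v
      ≈⟨ ∑-cong (splits v) (λ _ → sym (*-cong (+-identityʳ _) (+-identityʳ _))) ⟩
    ∑ (splits v) (λ (v₁ , v₂) → shuffleForm f [] v₁ * shuffleForm g [] v₂)
      ≈⟨ sym (+-identityʳ _) ⟩
    (shuffleForm f ⋆ shuffleForm g) [] v ∎
  shuffleForm-· f g (x ∷ u) [] = begin
    shuffleForm (f · g) (x ∷ u) []
      ≈⟨ shuffleForm-[]ʳ (f · g) (x ∷ u) ⟩
    (f · g) (x ∷ u)
      ≈⟨ ∑-cong (splits (x ∷ u)) (λ (u₁ , u₂) → sym (trans (+-identityʳ _)
           (*-cong (shuffleForm-[]ʳ f u₁) (shuffleForm-[]ʳ g u₂)))) ⟩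
    (shuffleForm f ⋆ shuffleForm g) (x ∷ u) [] ∎
  shuffleForm-· f g (x ∷ u) (y ∷ v) =
    trans (lhs (shuffleForm-· (∂ x f) g u (y ∷ v)) (shuffleForm-· (∂ y f) g (x ∷ u) v)) (sym rhs)
    where
    Ψ = shuffleForm
    Gˣ = Ψ (∂ x g) u (y ∷ v)
    Gʸ = Ψ (∂ y g) (x ∷ u) v
    P = ∑ (splits v) (λ (v₁ , v₂) → Ψ (∂ y f) [] v₁ * Ψ g (x ∷ u) v₂)
    Q = ∑ (splits u) (λ (u₁ , u₂) → Ψ (∂ x f) u₁ [] * Ψ g u₂ (y ∷ v))
    B₁ = ((λ u′ v′ → Ψ (∂ x f) u′ (y ∷ v′)) ⋆ Ψ g) u v
    B₂ = ((λ u′ → Ψ (∂ y f) (x ∷ u′)) ⋆ Ψ g) u v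

    lhs : Ψ (∂ x f · g) u (y ∷ v) ≈ (Ψ (∂ x f) ⋆ Ψ g) u (y ∷ v) →
          Ψ (∂ y f · g) (x ∷ u) v ≈ (Ψ (∂ y f) ⋆ Ψ g) (x ∷ u) v →
          Ψ (f · g) (x ∷ u) (y ∷ v) ≈ (f [] * (Gˣ + Gʸ) + P) + (Q + (B₁ + B₂))
    lhs ihˣ ihʸ = begin
      Ψ (f · g) (x ∷ u) (y ∷ v)
        ≈⟨ shuffleForm-∷ (f · g) x u y v ⟩
      Ψ (∂ x (f · g)) u (y ∷ v) + Ψ (∂ y (f · g)) (x ∷ u) v
        ≈⟨ +-cong (shuffleForm-·-∂ f g x u (y ∷ v)) (shuffleForm-·-∂ f g y (x ∷ u) v) ⟩
      (f [] * Gˣ + Ψ (∂ x f · g) u (y ∷ v)) + (f [] * Gʸ + Ψ (∂ y f · g) (x ∷ u) v)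
        ≈⟨ +-cong (+-congˡ (trans ihˣ (⋆-consʳ _ _ u y v))) (+-congˡ (trans ihʸ (⋆-consˡ _ _ x u v))) ⟩
      (f [] * Gˣ + (Q + B₁)) + (f [] * Gʸ + (P + B₂))
        ≈⟨ solve 6 (λ b e q b₁ p b₂ → (b ⊕ (q ⊕ b₁)) ⊕ (e ⊕ (p ⊕ b₂)) ⊜ ((b ⊕ e) ⊕ p) ⊕ (q ⊕ (b₁ ⊕ b₂)))
             refl (f [] * Gˣ) (f [] * Gʸ) Q B₁ P B₂ ⟩
      ((f [] * Gˣ + f [] * Gʸ) + P) + (Q + (B₁ + B₂))
        ≈⟨ +-congʳ (+-congʳ (sym (distribˡ _ _ _))) ⟩
      (f [] * (Gˣ + Gʸ) + P) + (Q + (B₁ + B₂)) ∎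

    rhs : (Ψ f ⋆ Ψ g) (x ∷ u) (y ∷ v) ≈ (f [] * (Gˣ + Gʸ) + P) + (Q + (B₁ + B₂))
    rhs = begin
      (Ψ f ⋆ Ψ g) (x ∷ u) (y ∷ v)
        ≈⟨ trans (⋆-consˡ _ _ x u (y ∷ v)) (+-congʳ (+-congˡ (∑-map (splits v) (map₁ (y ∷_)) _))) ⟩
      (Ψ f [] [] * Ψ g (x ∷ u) (y ∷ v) + P) + ((λ u′ → Ψ f (x ∷ u′)) ⋆ Ψ g) u (y ∷ v)
        ≈⟨ +-cong (+-congʳ (*-cong (+-identityʳ _) (shuffleForm-∷ g x u y v))) (⋆-consʳ _ _ u y v) ⟩
      (f [] * (Gˣ + Gʸ) + P)
        + (∑ (splits u) (λ (u₁ , u₂) → Ψ f (x ∷ u₁) [] * Ψ g u₂ (y ∷ v))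
           + ((λ u′ v′ → Ψ f (x ∷ u′) (y ∷ v′)) ⋆ Ψ g) u v)
        ≈⟨ +-congˡ (+-cong (∑-cong (splits u) λ (u₁ , _) → *-congʳ (∂-shuffleForm-[]ʳ u₁))
             (trans (⋆-cong (λ u′ v′ → shuffleForm-∷ f x u′ y v′) (λ _ _ → refl) u v)
                    (⋆-distribʳ-+ _ _ _ u v))) ⟩
      (f [] * (Gˣ + Gʸ) + P) + (Q + (B₁ + B₂)) ∎
      where
      ∂-shuffleForm-[]ʳ : ∀ w → Ψ f (x ∷ w) [] ≈ Ψ (∂ x f) w []
      ∂-shuffleForm-[]ʳ w = trans (shuffleForm-[]ʳ f (x ∷ w)) (sym (shuffleForm-[]ʳ (∂ x f) w))

  splits⁺ : Word → List (Word × Word)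
  splits⁺ []      = []
  splits⁺ (x ∷ w) = map (map₁ (x ∷_)) (splits w)

  splits⁻ : Word → List (Word × Word)
  splits⁻ []      = []
  splits⁻ (x ∷ w) = ([] , x ∷ w) ∷ map (map₁ (x ∷_)) (splits⁻ w)

  ∑-splits-first : ∀ w h → ∑ (splits w) h ≈ h ([] , w) + ∑ (splits⁺ w) h
  ∑-splits-first []      h = refl
  ∑-splits-first (_ ∷ _) h = refl

  ∑-splits-last : ∀ w h → ∑ (splits w) h ≈ ∑ (splits⁻ w) h + h (w , [])
  ∑-splits-last []      h = +-comm _ _
  ∑-splits-last (x ∷ w) h = begin
    h ([] , x ∷ w) + ∑ (map (map₁ (x ∷_)) (splits w)) h
      ≈⟨ +-congˡ (∑-map (splits w) (map₁ (x ∷_)) h) ⟩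
    h ([] , x ∷ w) + ∑ (splits w) (λ s → h (map₁ (x ∷_) s))
      ≈⟨ +-congˡ (∑-splits-last w _) ⟩
    h ([] , x ∷ w) + (∑ (splits⁻ w) (λ s → h (map₁ (x ∷_) s)) + h (x ∷ w , []))
      ≈⟨ sym (+-assoc _ _ _) ⟩
    (h ([] , x ∷ w) + ∑ (splits⁻ w) (λ s → h (map₁ (x ∷_) s))) + h (x ∷ w , [])
      ≈⟨ +-congʳ (+-congˡ (sym (∑-map (splits⁻ w) (map₁ (x ∷_)) h))) ⟩
    ∑ (splits⁻ (x ∷ w)) h + h (x ∷ w , []) ∎

  length-proj₁-splits : ∀ w → All (λ ((w₁ , _) : Word × Word) → length w₁ ≤ length w) (splits w)
  length-proj₁-splits []      = z≤n ∷ []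
  length-proj₁-splits (x ∷ w) = z≤n ∷ All.gmap⁺ s≤s (length-proj₁-splits w)

  length-proj₂-splits : ∀ w → All (λ ((_ , w₂) : Word × Word) → length w₂ ≤ length w) (splits w)
  length-proj₂-splits []      = z≤n ∷ []
  length-proj₂-splits (x ∷ w) = ℕ.≤-refl ∷ All.gmap⁺ ℕ.m≤n⇒m≤1+n (length-proj₂-splits w)

  length-proj₂-splits⁺ : ∀ w → All (λ ((_ , w₂) : Word × Word) → length w₂ < length w) (splits⁺ w)
  length-proj₂-splits⁺ []      = []
  length-proj₂-splits⁺ (x ∷ w) = All.gmap⁺ s≤s (length-proj₂-splits w)

  length-proj₁-splits⁻ : ∀ w → All (λ ((w₁ , _) : Word × Word) → length w₁ < length w) (splits⁻ w)
  length-proj₁-splits⁻ []      = []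
  length-proj₁-splits⁻ (x ∷ w) = s≤s z≤n ∷ All.gmap⁺ s≤s (length-proj₁-splits⁻ w)

  AgreeBelow : BiSer → BiSer → ℕ → Set (a ⊔ ℓ)
  AgreeBelow F G n = ∀ u v → length u ℕ.+ length v < n → F u v ≈ G u v

  ≋-by-length-induction : ∀ F G →
    (∀ u v → AgreeBelow F G (length u ℕ.+ length v) → F u v ≈ G u v) → F ≋ G
  ≋-by-length-induction F G step u v = agreeBelow (suc (length u ℕ.+ length v)) u v ℕ.≤-refl
    where
    agreeBelow : ∀ n → AgreeBelow F G n
    agreeBelow zero    u v ()
    agreeBelow (suc n) u v (s≤s le) = step u v λ u′ v′ lt → agreeBelow n u′ v′ (ℕ.<-≤-trans lt le)

  *-cancelˡ-≈1 : ∀ {e x y} → e ≈ 1# → e * x ≈ e * y → x ≈ y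
  *-cancelˡ-≈1 {e} {x} {y} e≈1 ex≈ey = begin
    x      ≈⟨ sym (*-identityˡ x) ⟩
    1# * x ≈⟨ *-congʳ (sym e≈1) ⟩
    e * x  ≈⟨ ex≈ey ⟩
    e * y  ≈⟨ *-congʳ e≈1 ⟩
    1# * y ≈⟨ *-identityˡ y ⟩
    y      ∎

  *-cancelʳ-≈1 : ∀ {e x y} → e ≈ 1# → x * e ≈ y * e → x ≈ y
  *-cancelʳ-≈1 e≈1 xe≈ye = *-cancelˡ-≈1 e≈1 (trans (*-comm _ _) (trans xe≈ye (*-comm _ _)))

  -- C ⋆ H at (u, v) is C [] [] * H u v plus terms involving H only at shorter pairs.
  ⋆-cancelˡ : ∀ C F G → C [] [] ≈ 1# → C ⋆ F ≋ C ⋆ G → F ≋ G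
  ⋆-cancelˡ C F G C₀≈1 CF≋CG = ≋-by-length-induction F G λ u v below →
    let Xᶠ≈Xᵍ : X u v F ≈ X u v G
        Xᶠ≈Xᵍ = ∑-congᴬ (All.map (λ lt → *-congˡ (below _ _ (ℕ.+-monoʳ-< (length u) lt)))
                                 (length-proj₂-splits⁺ v))
        Yᶠ≈Yᵍ : Y u v F ≈ Y u v G
        Yᶠ≈Yᵍ = ∑-congᴬ (All.map (λ lt → ∑-congᴬ (All.map (λ le → *-congˡ (below _ _ (ℕ.+-mono-<-≤ lt le)))
                                                         (length-proj₂-splits v)))
                                 (length-proj₂-splits⁺ u))
    in *-cancelˡ-≈1 C₀≈1 (∙-cancelʳ (X u v F) _ _ (∙-cancelʳ (Y u v F) _ _ (begin
      (C [] [] * F u v + X u v F) + Y u v F ≈⟨ sym (decompose u v F) ⟩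
      (C ⋆ F) u v                           ≈⟨ CF≋CG u v ⟩
      (C ⋆ G) u v                           ≈⟨ decompose u v G ⟩
      (C [] [] * G u v + X u v G) + Y u v G ≈⟨ +-cong (+-congˡ (sym Xᶠ≈Xᵍ)) (sym Yᶠ≈Yᵍ) ⟩
      (C [] [] * G u v + X u v F) + Y u v F ∎)))
    where
    X Y : Word → Word → BiSer → Carrier
    X u v H = ∑ (splits⁺ v) (λ (v₁ , v₂) → C [] v₁ * H u v₂)
    Y u v H = ∑ (splits⁺ u) (λ (u₁ , u₂) → ∑ (splits v) λ (v₁ , v₂) → C u₁ v₁ * H u₂ v₂)
    decompose : ∀ u v H → (C ⋆ H) u v ≈ (C [] [] * H u v + X u v H) + Y u v H
    decompose u v H = trans (∑-splits-first u _) (+-congʳ (∑-splits-first v _))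

  ⋆-cancelʳ : ∀ C F G → C [] [] ≈ 1# → F ⋆ C ≋ G ⋆ C → F ≋ G
  ⋆-cancelʳ C F G C₀≈1 FC≋GC = ≋-by-length-induction F G λ u v below →
    let Xᶠ≈Xᵍ : X u v F ≈ X u v G
        Xᶠ≈Xᵍ = ∑-congᴬ (All.map (λ lt → *-congʳ (below _ _ (ℕ.+-monoʳ-< (length u) lt)))
                                 (length-proj₁-splits⁻ v))
        Yᶠ≈Yᵍ : Y u v F ≈ Y u v G
        Yᶠ≈Yᵍ = ∑-congᴬ (All.map (λ lt → ∑-congᴬ (All.map (λ le → *-congʳ (below _ _ (ℕ.+-mono-<-≤ lt le)))
                                                         (length-proj₁-splits v)))
                                 (length-proj₁-splits⁻ u))
    in *-cancelʳ-≈1 C₀≈1 (∙-cancelˡ (X u v F) _ _ (∙-cancelˡ (Y u v F) _ _ (begin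
      Y u v F + (X u v F + F u v * C [] []) ≈⟨ sym (decompose u v F) ⟩
      (F ⋆ C) u v                           ≈⟨ FC≋GC u v ⟩
      (G ⋆ C) u v                           ≈⟨ decompose u v G ⟩
      Y u v G + (X u v G + G u v * C [] []) ≈⟨ +-cong (sym Yᶠ≈Yᵍ) (+-congʳ (sym Xᶠ≈Xᵍ)) ⟩
      Y u v F + (X u v F + G u v * C [] []) ∎)))
    where
    X Y : Word → Word → BiSer → Carrier
    X u v H = ∑ (splits⁻ v) (λ (v₁ , v₂) → H u v₁ * C [] v₂)
    Y u v H = ∑ (splits⁻ u) (λ (u₁ , u₂) → ∑ (splits v) λ (v₁ , v₂) → H u₁ v₁ * C u₂ v₂)
    decompose : ∀ u v H → (H ⋆ C) u v ≈ Y u v H + (X u v H + H u v * C [] [])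
    decompose u v H = trans (∑-splits-last u _) (+-congˡ (∑-splits-last v _))

  inv : Ser → Ser
  inv = invₛ {A = A} R

  one : Ser
  one = oneₛ {A = A} R

  invAux-fuel-irrelevant : ∀ f m n w → length w ≤ m → length w ≤ n →
    invAux {A = A} R m f w ≈ invAux {A = A} R n f w
  invAux-fuel-irrelevant f m       n       []      _       _       = refl
  invAux-fuel-irrelevant f (suc m) (suc n) (x ∷ w) (s≤s p) (s≤s q) = -‿cong (∑-congᴬ (All.map
    (λ {(_ , w₂)} le → *-congˡ (invAux-fuel-irrelevant f m n w₂ (ℕ.≤-trans le p) (ℕ.≤-trans le q)))
    (length-proj₂-splits w)))

  ·-inverseʳ : ∀ g → g [] ≈ 1# → _≈ₛ_ R (g · inv g) one
  ·-inverseʳ g g₀≈1 []      = trans (+-identityʳ _) (trans (*-identityʳ _) g₀≈1)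
  ·-inverseʳ g g₀≈1 (x ∷ w) = begin
    (g · inv g) (x ∷ w)      ≈⟨ ·-∂ g (inv g) x w ⟩
    g [] * (- S′) + S        ≈⟨ +-congʳ (*-cong g₀≈1 (-‿cong S′≈S)) ⟩
    1# * (- S) + S           ≈⟨ +-congʳ (*-identityˡ _) ⟩
    - S + S                  ≈⟨ -‿inverseˡ S ⟩
    0#                       ∎
    where
    S′ S : Carrier
    S′ = ∑ (splits w) (λ (w₁ , w₂) → g (x ∷ w₁) * invAux {A = A} R (length w) g w₂)
    S  = (∂ x g · inv g) w
    S′≈S : S′ ≈ S
    S′≈S = ∑-congᴬ (All.map
      (λ {(_ , w₂)} le → *-congˡ (invAux-fuel-irrelevant g (length w) (length w₂) w₂ le ℕ.≤-refl))
      (length-proj₂-splits w))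

  IsShuffle-cong : ∀ {f g} → _≈ₛ_ R f g → IsShuffle f → IsShuffle g
  IsShuffle-cong f≈g shuffle-f u v =
    trans (sym (*-cong (f≈g u) (f≈g v))) (trans (shuffle-f u v) (∑-cong (Sh u v) f≈g))

  IsShuffle-one : IsShuffle one
  IsShuffle-one []      []      = trans (*-identityˡ _) (sym (+-identityʳ _))
  IsShuffle-one []      (_ ∷ _) = trans (zeroʳ _) (sym (+-identityʳ _))
  IsShuffle-one (_ ∷ _) []      = trans (zeroˡ _) (sym (+-identityʳ _))
  IsShuffle-one (x ∷ u) (y ∷ v) = trans (zeroˡ _) (sym (begin
    shuffleForm one (x ∷ u) (y ∷ v)      ≈⟨ shuffleForm-∷ one x u y v ⟩
    ∑ (Sh u (y ∷ v)) (λ _ → 0#) + ∑ (Sh (x ∷ u) v) (λ _ → 0#)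
                                         ≈⟨ +-cong (∑-zero (Sh u (y ∷ v))) (∑-zero (Sh (x ∷ u) v)) ⟩
    0# + 0#                              ≈⟨ +-identityˡ 0# ⟩
    0#                                   ∎))

  IsShuffle-· : ∀ f g → IsShuffle f → IsShuffle g → IsShuffle (f · g)
  IsShuffle-· f g shuffle-f shuffle-g u v = begin
    prodForm (f · g) u v                   ≈⟨ prodForm-· f g u v ⟩
    (prodForm f ⋆ prodForm g) u v          ≈⟨ ⋆-cong shuffle-f shuffle-g u v ⟩
    (shuffleForm f ⋆ shuffleForm g) u v    ≈⟨ shuffleForm-· f g u v ⟨
    shuffleForm (f · g) u v                ∎

  IsShuffle-inv : ∀ g → g [] ≈ 1# → IsShuffle g → IsShuffle (inv g)
  IsShuffle-inv g g₀≈1 shuffle-g =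
    ⋆-cancelˡ (prodForm g) _ _ (trans (*-cong g₀≈1 g₀≈1) (*-identityˡ 1#)) λ u v → begin
      (prodForm g ⋆ prodForm (inv g)) u v     ≈⟨ prodForm-· g (inv g) u v ⟨
      prodForm (g · inv g) u v                ≈⟨ *-cong (g·g⁻¹≈1 u) (g·g⁻¹≈1 v) ⟩
      prodForm one u v                        ≈⟨ IsShuffle-one u v ⟩
      shuffleForm one u v                     ≈⟨ ∑-cong (Sh u v) g·g⁻¹≈1 ⟨
      shuffleForm (g · inv g) u v             ≈⟨ shuffleForm-· g (inv g) u v ⟩
      (shuffleForm g ⋆ shuffleForm (inv g)) u v ≈⟨ ⋆-cong shuffle-g (λ _ _ → refl) u v ⟨
      (prodForm g ⋆ shuffleForm (inv g)) u v  ∎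
    where
    g·g⁻¹≈1 = ·-inverseʳ g g₀≈1

  IsShuffle-cancelʳ : ∀ f h → h [] ≈ 1# → IsShuffle h → IsShuffle (f · h) → IsShuffle f
  IsShuffle-cancelʳ f h h₀≈1 shuffle-h shuffle-fh =
    ⋆-cancelʳ (prodForm h) _ _ (trans (*-cong h₀≈1 h₀≈1) (*-identityˡ 1#)) λ u v → begin
      (prodForm f ⋆ prodForm h) u v          ≈⟨ prodForm-· f h u v ⟨
      prodForm (f · h) u v                   ≈⟨ shuffle-fh u v ⟩
      shuffleForm (f · h) u v                ≈⟨ shuffleForm-· f h u v ⟩
      (shuffleForm f ⋆ shuffleForm h) u v    ≈⟨ ⋆-cong (λ _ _ → refl) shuffle-h u v ⟨
      (shuffleForm f ⋆ prodForm h) u v       ∎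

coprime-+-* : ∀ p x k → Coprime p x → Coprime p (x ℤ.+ k ℤ.* p)
coprime-+-* p x k cop {d} (d∣p , d∣x+kp) = cop (d∣p , ℤ.∣⇒∣ᵤ d∣x)
  where
  d∣x : + d ℤ.∣ x
  d∣x = ℤ.∣m+n∣n⇒∣m (ℤ.∣ᵤ⇒∣ d∣x+kp) (ℤ.∣n⇒∣m*n k (ℤ.∣ᵤ⇒∣ d∣p))

x+kp-kp≡x : ∀ x k p → (x ℤ.+ k ℤ.* p) ℤ.+ (ℤ.- k) ℤ.* p ≡ x
x+kp-kp≡x = solve-∀

coprime-+-*⁻ : ∀ p x k → Coprime p (x ℤ.+ k ℤ.* p) → Coprime p x
coprime-+-*⁻ p x k cop =
  ≡.subst (Coprime p) (x+kp-kp≡x x k p) (coprime-+-* p (x ℤ.+ k ℤ.* p) (ℤ.- k) cop)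

coprime-neg-swap : ∀ p q → Coprime p q → Coprime (ℤ.- q) p
coprime-neg-swap p q cop =
  ≡.subst (λ n → ℕCoprime.Coprime n ∣ p ∣) (≡.sym (ℤ.∣-i∣≡∣i∣ q)) (ℤCoprime.sym {p} {q} cop)

module ShuffledDedekindSymbol {a c ℓ} (R : CommutativeRing c ℓ) (A : Set a)
  (D : SymbolMap {A = A} R) (isD : IsMultipleDedekindSymbol R D) where
  open CommutativeRing R using (sym)
  open ShuffleAlgebra R A
  open IsMultipleDedekindSymbol isD

  ShuffledAt : ℤ → ℤ → Set (a ⊔ ℓ)
  ShuffledAt p q = IsShuffle (D p q)

  shuffledAt-periodic : ∀ {p q} → Coprime p q → ShuffledAt p q ⇔ ShuffledAt p (p ℤ.+ q)
  shuffledAt-periodic {p} {q} cop =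
    mk⇔ (IsShuffle-cong (periodic p q cop)) (IsShuffle-cong (λ w → sym (periodic p q cop w)))

  shuffledAt-+-* : ∀ {p x} n → Coprime p x → ShuffledAt p x ⇔ ShuffledAt p (x ℤ.+ + n ℤ.* p)
  shuffledAt-+-* {p} {x} zero _ =
    ≡.subst (λ y → ShuffledAt p x ⇔ ShuffledAt p y) (≡.sym (x+0p≡x x p)) ⇔.refl
    where
    x+0p≡x : ∀ x p → x ℤ.+ 0ℤ ℤ.* p ≡ x
    x+0p≡x = solve-∀
  shuffledAt-+-* {p} {x} (suc n) cop = ⇔.trans (shuffledAt-+-* n cop)
    (≡.subst (λ y → ShuffledAt p (x ℤ.+ + n ℤ.* p) ⇔ ShuffledAt p y)
      (≡.sym (x+[1+n]p≡p+[x+np] x (+ n) p))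
      (shuffledAt-periodic (coprime-+-* p x (+ n) cop)))
    where
    x+[1+n]p≡p+[x+np] : ∀ x n p → x ℤ.+ (1ℤ ℤ.+ n) ℤ.* p ≡ p ℤ.+ (x ℤ.+ n ℤ.* p)
    x+[1+n]p≡p+[x+np] = solve-∀

  shuffledAt-+-*ℤ : ∀ {p x} k → Coprime p x → ShuffledAt p x → ShuffledAt p (x ℤ.+ k ℤ.* p)
  shuffledAt-+-*ℤ (+ n) cop = Equivalence.to (shuffledAt-+-* n cop)
  shuffledAt-+-*ℤ {p} {x} k@(-[1+ n ]) cop shuffled =
    Equivalence.from (shuffledAt-+-* (suc n) (coprime-+-* p x k cop))
      (≡.subst (ShuffledAt p) (≡.sym (x+kp-kp≡x x k p)) shuffled)

  shuffledAt-neg : ∀ {p q} → Coprime p q → ShuffledAt (ℤ.- p) q → ShuffledAt p (ℤ.- q)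
  shuffledAt-neg {p} {q} cop = IsShuffle-cong (λ w → sym (sym-sign p q cop w))

  module _ (normalized : Normalized R D) (reciprocity-shuffled : Shuffled R (assocReciprocity R D)) where

    shuffledAt-swap : ∀ {p q} → Coprime p q → ShuffledAt (ℤ.- q) p → ShuffledAt p q
    shuffledAt-swap {p} {q} cop shuffled =
      IsShuffle-cancelʳ (D p q) (inv (D (ℤ.- q) p)) refl
        (IsShuffle-inv (D (ℤ.- q) p) (const-one (ℤ.- q) p (coprime-neg-swap p q cop)) shuffled)
        (λ u v → reciprocity-shuffled u v p q cop)
      where open CommutativeRing R using (refl)

    cop₀₁ : Coprime 0ℤ 1ℤ
    cop₀₁ = ℕCoprime.sym (ℕCoprime.1-coprimeTo 0)

    shuffledAt-0-1 : ShuffledAt 0ℤ 1ℤ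
    shuffledAt-0-1 = shuffledAt-swap cop₀₁
      (IsShuffle-cong (sym-sign 1ℤ 0ℤ cop₁₀) (Equivalence.from (shuffledAt-periodic cop₁₀) shuffledAt-1-1))
      where
      cop₁₀ : Coprime 1ℤ 0ℤ
      cop₁₀ = ℕCoprime.1-coprimeTo 0
      shuffledAt-1-1 : ShuffledAt 1ℤ 1ℤ
      shuffledAt-1-1 = IsShuffle-cong (λ w → sym (normalized w)) IsShuffle-one

    shuffledAt-0 : ∀ q → Coprime 0ℤ q → ShuffledAt 0ℤ q
    shuffledAt-0 q cop with ℕCoprime.0-coprimeTo-m⇒m≡1 {∣ q ∣} cop
    shuffledAt-0 (+ 1)     _ | ≡.refl = shuffledAt-0-1
    shuffledAt-0 -[1+ 0 ] _ | ≡.refl = shuffledAt-neg cop₀₁ shuffledAt-0-1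

    shuffledAt-euclid : ∀ p .{{_ : ℤ.NonZero p}} →
      (∀ {p′} → ∣ p′ ∣ < ∣ p ∣ → ∀ q → Coprime p′ q → ShuffledAt p′ q) →
      ∀ q → Coprime p q → ShuffledAt p q
    shuffledAt-euclid p ih q cop =
      ≡.subst (ShuffledAt p) (≡.sym q≡r+[q/p]p) (shuffledAt-+-*ℤ (q ℤ./ p) cop-r shuffled-r)
      where
      r = q ℤ.% p
      q≡r+[q/p]p : q ≡ + r ℤ.+ (q ℤ./ p) ℤ.* p
      q≡r+[q/p]p = ℤ.a≡a%n+[a/n]*n q p
      cop-r : Coprime p (+ r)
      cop-r = coprime-+-*⁻ p (+ r) (q ℤ./ p) (≡.subst (Coprime p) q≡r+[q/p]p cop)
      ∣-r∣<∣p∣ : ∣ ℤ.- + r ∣ < ∣ p ∣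
      ∣-r∣<∣p∣ = ≡.subst (_< ∣ p ∣) (≡.sym (ℤ.∣-i∣≡∣i∣ (+ r))) (ℤ.n%d<d q p)
      shuffled-r : ShuffledAt p (+ r)
      shuffled-r = shuffledAt-swap cop-r (ih ∣-r∣<∣p∣ p (coprime-neg-swap p (+ r) cop-r))

    shuffledAt : ∀ p q → Coprime p q → ShuffledAt p q
    shuffledAt = WF.All.wfRec (On.wellFounded ∣_∣ <-wellFounded) (a ⊔ ℓ)
      (λ p → ∀ q → Coprime p q → ShuffledAt p q) step
      where
      step : ∀ p → (∀ {p′} → ∣ p′ ∣ < ∣ p ∣ → ∀ q → Coprime p′ q → ShuffledAt p′ q) →
             ∀ q → Coprime p q → ShuffledAt p q
      step (+ zero)   _ = shuffledAt-0
      step p@(+ suc _)  = shuffledAt-euclid p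
      step p@(-[1+ _ ]) = shuffledAt-euclid p

  shuffled⇒reciprocity-shuffled : Shuffled R D → Shuffled R (assocReciprocity R D)
  shuffled⇒reciprocity-shuffled shuffled u v p q cop =
    IsShuffle-· (D p q) (inv (D (ℤ.- q) p)) (λ u′ v′ → shuffled u′ v′ p q cop)
      (IsShuffle-inv (D (ℤ.- q) p) (const-one (ℤ.- q) p cop′) (λ u′ v′ → shuffled u′ v′ (ℤ.- q) p cop′))
      u v
    where cop′ = coprime-neg-swap p q cop

  reciprocity-shuffled⇒shuffled : Normalized R D → Shuffled R (assocReciprocity R D) → Shuffled R D
  reciprocity-shuffled⇒shuffled normalized reciprocity-shuffled u v p q cop =
    shuffledAt normalized reciprocity-shuffled p q cop u v

theorem4p10 : ∀ {a c ℓ} (R : CommutativeRing c ℓ) (A : Set a) (D : SymbolMap {A = A} R) →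
    IsMultipleDedekindSymbol R D → Normalized R D →
    (Shuffled R D ⇔ Shuffled R (assocReciprocity R D))
theorem4p10 R A D isD normalized =
  mk⇔ shuffled⇒reciprocity-shuffled (reciprocity-shuffled⇒shuffled normalized)
  where open ShuffledDedekindSymbol R A D isD
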